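{- Let $G=(V,E)$ be a graph satisfying the standing assumptions and let $u\in V$ with $\tau(u)=3$. (1) $G_i(u)$ is well defined and nonempty for every $1\le i\le\ell_u$. (2) If $(u_i)_{i\ge1}$ is an occurrence of $\min_u$ starting at $u$, then $u_i\in G_i(u)$ for every $1\le i\le\ell_u$; in particular $\tau(u_i)=\tau(G_i(u))$ and $\min_u[i]=\lambda(u_i)=\lambda(G_i(u))$ for every $1\le i\le\ell_u$. (3) For every $1\le i\le\ell_u$ and every $v\in G_i(u)$ there exists an occurrence of $\min_u[1,i-1]$ starting at $u$ and ending at $v$.
   Context: Standing assumptions: $\Sigma$ is a finite alphabet with a total order $\preceq$; $G=(V,E)$ is finite, $E\subseteq V\times V\times\Sigma$, every node has an incoming edge, all edges entering a node $u$ have the same label $\lambda(u)$ (edges are written $(u,v)$), and $G$ is deterministic. An occurrence of $\alpha\in\Sigma^\omega$ starting at $u$ is a sequence $(u_i)_{i\ge1}$ with $u_1=u$, $(u_{i+1},u_i)\in E$, $\lambda(u_i)=\alpha[i]$; an occurrence of a finite string $\alpha$ starting at $u$ and ending at $u'$ is a sequence $u_1,\dots,u_{|\alpha|+1}$ with $u_1=u$, $u_{|\alpha|+1}=u'$, $(u_{i+1},u_i)\in E$ and $\lambda(u_i)=\alpha[i]$ for $1\le i\le|\alpha|$. $\min_u$ is the lexicographically smallest string in $\Sigma^\omega$ with an occurrence starting at $u$; $\alpha[i,j]=\alpha[i]\cdots\alpha[j]$ (empty if $j<i$). For $\alpha=a\alpha'$: $\tau(\alpha)=1$ if $\alpha'\prec\alpha$,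 $2$ if $\alpha'=\alpha$, $3$ if $\alpha\prec\alpha'$; $\tau(u):=\tau(\min_u)$. For $\tau(u)=3$, $\ell_u$ is the smallest $k\ge2$ with $\tau(u_k)\ge2$ for an (any) occurrence $(u_i)$ of $\min_u$ starting at $u$. For nonempty $R\subseteq V$ let $R'=\arg\min_{v\in R}\lambda(v)$ and $\mathtt{F}(R)=\arg\min_{v\in R'}\tau(v)$. Define $G_1(u)=\{u\}$ and for $1<i\le\ell_u$, $G_i(u)=\mathtt{F}(\{v'\in V:\exists v\in G_{i-1}(u),(v',v)\in E\})\setminus\bigcup_{j=2}^{i-1}G_j(u)$. For a nonempty set $R$ whose nodes all share the same $\lambda$ (resp. $\tau$) value, $\lambda(R)$ (resp. $\tau(R)$) denotes that common value. -}

module Defs where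

open import Data.Nat using (ℕ; zero; suc; _≤_; _<_; _∸_)
open import Data.Fin using (Fin) renaming (_≤_ to _≤ᶠ_; _<_ to _<ᶠ_)
open import Data.Product using (Σ; ∃; _×_; _,_)
open import Data.Sum using (_⊎_)
open import Data.Empty using (⊥)
open import Relation.Nullary using (¬_)
open import Relation.Binary.PropositionalEquality using (_≡_)

-- Conventions:
--  * Alphabet Σ = Fin k with its natural (total) order; every finite totally
--    ordered alphabet is order-isomorphic to such a Fin k.
--  * Node set V = Fin n (a finite set).
--  * E v w means that the edge (v,w) is present; its label is λ w.
--  * Infinite strings are streams ℕ → Fin k, indexed from 0:
--    paper's α[i] (1-based) is our α (i ∸ 1).  Likewise occurrences are
--    sequences ℕ → Fin n, paper's u_i is our o (i ∸ 1).

Str : ℕ → Set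
Str k = ℕ → Fin k

record Graph (n k : ℕ) : Set₁ where
  field
    λ' : Fin n → Fin k
    E  : Fin n → Fin n → Set
    incoming : ∀ v → ∃ λ w → E w v
    deterministic : ∀ v w w' → E v w → E v w' → λ' w ≡ λ' w' → w ≡ w'

_≺_ : ∀ {k} → Str k → Str k → Set
α ≺ β = ∃ λ j → (∀ i → i < j → α i ≡ β i) × (α j <ᶠ β j)

_≈_ : ∀ {k} → Str k → Str k → Set
α ≈ β = ∀ i → α i ≡ β i

_⪯_ : ∀ {k} → Str k → Str k → Set
α ⪯ β = α ≺ β ⊎ α ≈ β

tail : ∀ {k} → Str k → Str k
tail α i = α (suc i)

data Tau {k} (α : Str k) : ℕ → Set where
  tau1 : tail α ≺ α → Tau α 1
  tau2 : tail α ≈ α → Tau α 2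
  tau3 : α ≺ tail α → Tau α 3

module _ {n k : ℕ} (G : Graph n k) where
  open Graph G

  IsOcc : Fin n → Str k → (ℕ → Fin n) → Set
  IsOcc u α o = (o 0 ≡ u) × (∀ i → E (o (suc i)) (o i)) × (∀ i → λ' (o i) ≡ α i)

  HasOcc : Fin n → Str k → Set
  HasOcc u α = ∃ λ o → IsOcc u α o

  IsMin : Fin n → Str k → Set
  IsMin u α = HasOcc u α × (∀ β → HasOcc u β → α ⪯ β)

  -- occurrence of the finite string α[1,len] (paper indexing) starting at u,
  -- ending at u':  nodes o 0 , … , o len
  IsFinOcc : Fin n → Str k → ℕ → Fin n → (ℕ → Fin n) → Set
  IsFinOcc u α len u' o =
    (o 0 ≡ u) × (o len ≡ u') ×
    (∀ i → i < len → E (o (suc i)) (o i) × (λ' (o i) ≡ α i))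

  -- Everything below is relative to a function m assigning to each node v
  -- its string min_v (m is unique up to ≈ when it exists).
  module _ (m : Fin n → Str k) where

    τ : Fin n → ℕ → Set
    τ v t = Tau (m v) t

    IsEll : Fin n → ℕ → Set
    IsEll u l = ∃ λ o → IsOcc u (m u) o ×
      (2 ≤ l) ×
      (∀ t → τ (o (l ∸ 1)) t → 2 ≤ t) ×
      (∀ j → 2 ≤ j → j < l → ∀ t → τ (o (j ∸ 1)) t → t < 2)

    Pred : Set₁
    Pred = Fin n → Set

    ArgMinλ : Pred → Pred
    ArgMinλ R v = R v × (∀ w → R w → λ' v ≤ᶠ λ' w)

    F : Pred → Pred
    F R v = ArgMinλ R v ×
      (∀ w → ArgMinλ R w → ∀ tv tw → τ v tv → τ w tw → tv ≤ tw)

    InNbr : Pred → Pred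
    InNbr R v' = ∃ λ v → R v × E v' v

    -- G_i(u) (1-based i; G 0 is unused and empty) together with
    -- U i = ⋃_{j=2}^{i} G_j(u)
    module _ (u : Fin n) where
      mutual
        Gset : ℕ → Pred
        Gset zero v = ⊥
        Gset (suc zero) v = v ≡ u
        Gset (suc (suc i)) v = F (InNbr (Gset (suc i))) v × ¬ U (suc i) v

        U : ℕ → Pred
        U zero v = ⊥
        U (suc zero) v = ⊥
        U (suc (suc i)) v = U (suc i) v ⊎ Gset (suc (suc i)) v

{-# OPTIONS --safe #-}
module Submission where

-- Minimality is inherited along backward walks: if a walk from u spells min_u[1,j], its end v has
-- min_v ⪰ drop j min_u, with equality when the walk follows an occurrence of min_u. Hence, by
-- induction on i, the node u_i of any occurrence of min_u is an in-neighbour of G_{i-1}(u) of least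
-- label and, τ being monotone on strings with a common head, of least τ; and u_i occurs in no
-- earlier G_j(u), because τ(u_j) = 1 for 1 < j < ℓ_u makes the suffixes of min_u strictly decrease.
-- τ is defined on every min string since these are eventually periodic (pigeonhole on a walk).

open import Defs
open import Data.Nat using (ℕ; zero; suc; _≤_; _<_; _∸_; _+_; z≤n; s≤s; _≟_)
open import Data.Nat.Properties
  using (≤-refl; ≤-trans; ≤-antisym; <-trans; <-cmp; <⇒≤; ≮⇒≥; n<1+n; m<n⇒m<1+n; m≤n⇒m≤1+n; n≤1+n;
         m<1+n⇒m<n∨m≡n; 1+n≰n; ≤-<-trans; +-suc; m+[n∸m]≡n; +-monoˡ-<; _<?_)
open import Data.Nat.Induction using (<-rec)
open import Data.Fin using (Fin; toℕ) renaming (_<_ to _<ᶠ_; _≤_ to _≤ᶠ_)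
import Data.Fin.Properties as Fin
open import Data.Product using (∃; ∃₂; _×_; _,_; proj₁; proj₂)
open import Data.Sum using (_⊎_; inj₁; inj₂; [_,_])
open import Data.Empty using (⊥-elim)
open import Function using (_∘_)
open import Function.Bundles using (_⇔_; mk⇔)
open import Relation.Nullary using (¬_; yes; no)
open import Relation.Binary.Definitions using (tri<; tri≈; tri>)
open import Relation.Binary.PropositionalEquality
  using (_≡_; _≢_; refl; sym; trans; cong; subst; subst₂; module ≡-Reasoning)

private
  variable
    k : ℕ
    a : Fin k
    α β γ : Str k

drop : ℕ → Str k → Str k
drop zero    α = α
drop (suc j) α = drop j (tail α)

drop-+ : ∀ j (α : Str k) i → drop j α i ≡ α (j + i)
drop-+ zero    α i = refl
drop-+ (suc j) α i = drop-+ j (tail α) i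

drop-head : ∀ j (α : Str k) → drop j α 0 ≡ α j
drop-head zero    α = refl
drop-head (suc j) α = drop-head j (tail α)

drop-tail : ∀ j (α : Str k) → tail (drop j α) ≈ drop (suc j) α
drop-tail zero    α i = refl
drop-tail (suc j) α i = drop-tail j (tail α) i

≈-sym : α ≈ β → β ≈ α
≈-sym e i = sym (e i)

≈-trans : α ≈ β → β ≈ γ → α ≈ γ
≈-trans e f i = trans (e i) (f i)

≺-irrefl : ¬ (α ≺ α)
≺-irrefl (_ , _ , lt) = Fin.<-irrefl refl lt

≺-trans : α ≺ β → β ≺ γ → α ≺ γ
≺-trans {α = α} {γ = γ} (j , eq , lt) (j′ , eq′ , lt′) with <-cmp j j′
... | tri< j<j′ _ _ =
  j , (λ i i<j → trans (eq i i<j) (eq′ i (<-trans i<j j<j′))) , subst (α j <ᶠ_) (eq′ j j<j′) lt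
... | tri≈ _ refl _ = j , (λ i i<j → trans (eq i i<j) (eq′ i i<j)) , Fin.<-trans lt lt′
... | tri> _ _ j′<j =
  j′ , (λ i i<j′ → trans (eq i (<-trans i<j′ j′<j)) (eq′ i i<j′)) , subst (_<ᶠ γ j′) (sym (eq j′ j′<j)) lt′

≺-respʳ-≈ : α ≺ β → β ≈ γ → α ≺ γ
≺-respʳ-≈ {α = α} (j , eq , lt) e = j , (λ i i<j → trans (eq i i<j) (e i)) , subst (α j <ᶠ_) (e j) lt

≺-respˡ-≈ : α ≈ β → β ≺ γ → α ≺ γ
≺-respˡ-≈ {γ = γ} e (j , eq , lt) = j , (λ i i<j → trans (e i) (eq i i<j)) , subst (_<ᶠ γ j) (sym (e j)) lt

≺-⪯-trans : α ≺ β → β ⪯ γ → α ≺ γ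
≺-⪯-trans α≺β (inj₁ β≺γ) = ≺-trans α≺β β≺γ
≺-⪯-trans α≺β (inj₂ β≈γ) = ≺-respʳ-≈ α≺β β≈γ

⪯-trans : α ⪯ β → β ⪯ γ → α ⪯ γ
⪯-trans (inj₁ α≺β) β⪯γ        = inj₁ (≺-⪯-trans α≺β β⪯γ)
⪯-trans (inj₂ α≈β) (inj₁ β≺γ) = inj₁ (≺-respˡ-≈ α≈β β≺γ)
⪯-trans (inj₂ α≈β) (inj₂ β≈γ) = inj₂ (≈-trans α≈β β≈γ)

≺⇒⋡ : α ≺ β → ¬ (β ⪯ α)
≺⇒⋡ α≺β β⪯α = ≺-irrefl (≺-⪯-trans α≺β β⪯α)

⪯-antisym : α ⪯ β → β ⪯ α → α ≈ β
⪯-antisym (inj₂ α≈β) _          = α≈β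
⪯-antisym (inj₁ α≺β) β⪯α        = ⊥-elim (≺⇒⋡ α≺β β⪯α)

⪯-head : α ⪯ β → α 0 ≤ᶠ β 0
⪯-head (inj₁ (zero  , _  , lt)) = <⇒≤ lt
⪯-head (inj₁ (suc j , eq , _))  = Fin.≤-reflexive (eq 0 (s≤s z≤n))
⪯-head (inj₂ e)                 = Fin.≤-reflexive (e 0)

⪯-tail : α 0 ≡ β 0 → α ⪯ β → tail α ⪯ tail β
⪯-tail e (inj₁ (zero  , _  , lt)) = ⊥-elim (Fin.<-irrefl e lt)
⪯-tail e (inj₁ (suc j , eq , lt)) = inj₁ (j , (λ i i<j → eq (suc i) (s≤s i<j)) , lt)
⪯-tail e (inj₂ α≈β)               = inj₂ (α≈β ∘ suc)

≺-descending : (f : ℕ → Str k) {q s : ℕ} → (∀ r → q ≤ r → r < s → f (suc r) ≺ f r) → q < s → f s ≺ f q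
≺-descending f {q} {suc s} step q<1+s with m<1+n⇒m<n∨m≡n q<1+s
... | inj₂ refl = step q ≤-refl (n<1+n q)
... | inj₁ q<s  =
  ≺-trans (step s (<⇒≤ q<s) (n<1+n s)) (≺-descending f (λ r q≤r r<s → step r q≤r (m<n⇒m<1+n r<s)) q<s)

firstDifference : (α β : Str k) (N : ℕ) →
  (∀ i → i < N → α i ≡ β i) ⊎ ∃ λ j → (∀ i → i < j → α i ≡ β i) × α j ≢ β j
firstDifference α β zero = inj₁ (λ _ ())
firstDifference α β (suc N) with firstDifference α β N
... | inj₂ difference = inj₂ difference
... | inj₁ agree with α N Fin.≟ β N
...   | yes eq = inj₁ λ i i<1+N → [ agree i , (λ { refl → eq }) ] (m<1+n⇒m<n∨m≡n i<1+N)
...   | no  ne = inj₂ (N , agree , ne)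

Tau-total : (N : ℕ) (α : Str k) → ((∀ i → i < N → α i ≡ α (suc i)) → tail α ≈ α) → ∃ (Tau α)
Tau-total N α stationary with firstDifference α (tail α) N
... | inj₁ agree = 2 , tau2 (stationary agree)
... | inj₂ (j , agree , ne) with Fin.<-cmp (α j) (α (suc j))
...   | tri< lt _ _ = 3 , tau3 (j , agree , lt)
...   | tri≈ _ eq _ = ⊥-elim (ne eq)
...   | tri> _ _ gt = 1 , tau1 (j , (λ i i<j → sym (agree i i<j)) , gt)

-- Strong induction on t: beyond B, a step of α is the same as the step B − A positions earlier.
periodic⇒tail≈ : ∀ {A B} (α : Str k) → A < B → drop A α ≈ drop B α →
  (∀ i → i < B → α (suc i) ≡ α i) → tail α ≈ α
periodic⇒tail≈ {A = A} {B} α A<B period prefix = <-rec _ stationary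
  where
  open ≡-Reasoning
  shift : ∀ d → α (A + d) ≡ α (B + d)
  shift d = trans (sym (drop-+ A α d)) (trans (period d) (drop-+ B α d))

  stationary : ∀ t → (∀ {s} → s < t → α (suc s) ≡ α s) → α (suc t) ≡ α t
  stationary t ih with t <? B
  ... | yes t<B = prefix t t<B
  ... | no  t≮B = begin
    α (suc t)        ≡⟨ cong (α ∘ suc) (sym B+d≡t) ⟩
    α (suc (B + d))  ≡⟨ cong α (sym (+-suc B d)) ⟩
    α (B + suc d)    ≡⟨ sym (shift (suc d)) ⟩
    α (A + suc d)    ≡⟨ cong α (+-suc A d) ⟩
    α (suc (A + d))  ≡⟨ ih A+d<t ⟩
    α (A + d)        ≡⟨ shift d ⟩
    α (B + d)        ≡⟨ cong α B+d≡t ⟩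
    α t              ∎
    where
    d = t ∸ B
    B+d≡t : B + d ≡ t
    B+d≡t = m+[n∸m]≡n (≮⇒≥ t≮B)
    A+d<t : A + d < t
    A+d<t = subst (A + d <_) B+d≡t (+-monoˡ-< d A<B)

const : Fin k → Str k
const a _ = a

cons : {A : Set} → A → (ℕ → A) → ℕ → A
cons x xs zero    = x
cons x xs (suc i) = xs i

stationary-prefix : ∀ j → (∀ i → i < j → α (suc i) ≡ α i) → ∀ i → i ≤ j → α i ≡ α 0
stationary-prefix j eq zero    _       = refl
stationary-prefix j eq (suc i) 1+i≤j = trans (eq i 1+i≤j) (stationary-prefix j eq i (<⇒≤ 1+i≤j))

-- τ(α) is the comparison of tail α with the constant stream on the head of α; that stream depends
-- only on the head letter, which makes Tau monotone along ⪯.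
tail≺const : tail α ≺ α → α 0 ≡ a → tail α ≺ const a
tail≺const {α = α} (j , eq , lt) refl =
  j , (λ i i<j → stationary-prefix j eq (suc i) i<j) ,
  subst (α (suc j) <ᶠ_) (stationary-prefix j eq j ≤-refl) lt

tail≈const : tail α ≈ α → α 0 ≡ a → tail α ≈ const a
tail≈const {α = α} e refl i = stationary-prefix (suc i) (λ j _ → e j) (suc i) ≤-refl

const≺tail : α ≺ tail α → α 0 ≡ a → const a ≺ tail α
const≺tail {α = α} (j , eq , lt) refl =
  j , (λ i i<j → sym (flat (suc i) i<j)) , subst (_<ᶠ α (suc j)) (flat j ≤-refl) lt
  where
  flat : ∀ i → i ≤ j → α i ≡ α 0
  flat = stationary-prefix j (λ i i<j → sym (eq i i<j))

Tau-positive : ∀ {t} → Tau α t → 1 ≤ t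
Tau-positive (tau1 _) = s≤s z≤n
Tau-positive (tau2 _) = s≤s z≤n
Tau-positive (tau3 _) = s≤s z≤n

Tau<2⇒tail≺ : ∀ {t} → Tau α t → t < 2 → tail α ≺ α
Tau<2⇒tail≺ (tau1 tail≺α) _ = tail≺α
Tau<2⇒tail≺ (tau2 _) (s≤s (s≤s ()))
Tau<2⇒tail≺ (tau3 _) (s≤s (s≤s ()))

Tau-mono : ∀ {s t} → α 0 ≡ β 0 → α ⪯ β → Tau α s → Tau β t → s ≤ t
Tau-mono _ _ (tau1 _) τβ       = Tau-positive τβ
Tau-mono _ _ (tau2 _) (tau2 _) = ≤-refl
Tau-mono _ _ (tau2 _) (tau3 _) = n≤1+n 2
Tau-mono _ _ (tau3 _) (tau3 _) = ≤-refl
Tau-mono e α⪯β (tau2 α₂) (tau1 β₁) =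
  ⊥-elim (≺⇒⋡ (tail≺const β₁ (sym e)) (⪯-trans (inj₂ (≈-sym (tail≈const α₂ refl))) (⪯-tail e α⪯β)))
Tau-mono e α⪯β (tau3 α₃) (tau1 β₁) =
  ⊥-elim (≺⇒⋡ (tail≺const β₁ (sym e)) (inj₁ (≺-⪯-trans (const≺tail α₃ refl) (⪯-tail e α⪯β))))
Tau-mono e α⪯β (tau3 α₃) (tau2 β₂) =
  ⊥-elim (≺-irrefl (≺-respʳ-≈ (≺-⪯-trans (const≺tail α₃ refl) (⪯-tail e α⪯β)) (tail≈const β₂ (sym e))))

module _ {n k : ℕ} (G : Graph n k) where
  open Graph G

  private
    variable
      u v w : Fin n
      o q : ℕ → Fin n
      j : ℕ

  Minimal : Fin n → Str k → Set
  Minimal u α = ∀ β → HasOcc G u β → α ⪯ β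

  occ-head : IsOcc G u α o → λ' u ≡ α 0
  occ-head (refl , _ , labels) = labels 0

  occ-tail : IsOcc G u α o → IsOcc G (o 1) (tail α) (o ∘ suc)
  occ-tail (_ , edges , labels) = refl , edges ∘ suc , labels ∘ suc

  occ-drop : ∀ j → IsOcc G u α o → HasOcc G (o j) (drop j α)
  occ-drop {o = o} zero (_ , edges , labels) = o , refl , edges , labels
  occ-drop (suc j) occ = occ-drop j (occ-tail occ)

  occ⇒finOcc : IsOcc G u α o → ∀ j → IsFinOcc G u α j (o j) o
  occ⇒finOcc (start , edges , labels) j = start , refl , λ i _ → edges i , labels i

  occ-cons : E w u → HasOcc G w β → HasOcc G u (cons (λ' u) β)
  occ-cons {u = u} e (r , refl , edges , labels) =
    cons u r , refl , (λ { zero → e ; (suc i) → edges i }) , (λ { zero → refl ; (suc i) → labels i })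

  Minimal-tail : Minimal u α → E w u → λ' u ≡ α 0 → Minimal w (tail α)
  Minimal-tail M e head β occ = ⪯-tail (sym head) (M _ (occ-cons e occ))

  Minimal-drop : ∀ j → Minimal u α → IsFinOcc G u α j v q → Minimal v (drop j α)
  Minimal-drop zero    M (refl , refl , _)     = M
  Minimal-drop (suc j) M (refl , end , steps) =
    Minimal-drop j (Minimal-tail M (proj₁ (steps 0 (s≤s z≤n))) (proj₂ (steps 0 (s≤s z≤n))))
      (refl , end , λ i i<j → steps (suc i) (s≤s i<j))

  extend : ℕ → (ℕ → Fin n) → Fin n → ℕ → Fin n
  extend j q w i with i ≟ suc j
  ... | yes _ = w
  ... | no  _ = q i

  extend-below : ∀ {i} → i ≤ j → extend j q w i ≡ q i
  extend-below {j = j} {i = i} i≤j with i ≟ suc j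
  ... | yes refl = ⊥-elim (1+n≰n i≤j)
  ... | no  _    = refl

  extend-at : extend j q w (suc j) ≡ w
  extend-at {j = j} with suc j ≟ suc j
  ... | yes _ = refl
  ... | no ne = ⊥-elim (ne refl)

  finOcc-extend : IsFinOcc G u α j v q → E w v → λ' v ≡ α j → IsFinOcc G u α (suc j) w (extend j q w)
  finOcc-extend {α = α} {j = j} {v = v} {q = q} {w = w} (start , end , steps) e label =
    trans (below z≤n) start , extend-at {j = j} {q = q} , step
    where
    below : ∀ {i} → i ≤ j → extend j q w i ≡ q i
    below = extend-below {j = j} {q = q} {w = w}

    at-v : extend j q w j ≡ v
    at-v = trans (below ≤-refl) end

    step : ∀ i → i < suc j → E (extend j q w (suc i)) (extend j q w i) × λ' (extend j q w i) ≡ α i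
    step i i<1+j with m<1+n⇒m<n∨m≡n i<1+j
    ... | inj₁ i<j =
      subst₂ E (sym (below i<j)) (sym (below (<⇒≤ i<j))) (proj₁ (steps i i<j)) ,
      trans (cong λ' (below (<⇒≤ i<j))) (proj₂ (steps i i<j))
    ... | inj₂ refl = subst₂ E (sym (extend-at {j = j} {q = q})) (sym at-v) e , trans (cong λ' at-v) label

  module _ (m : Fin n → Str k) (mins : ∀ v → IsMin G v (m v)) where

    min-occ : ∀ v → HasOcc G v (m v)
    min-occ v = proj₁ (mins v)

    minimal : ∀ v → Minimal v (m v)
    minimal v = proj₂ (mins v)

    λ≡min-head : ∀ v → λ' v ≡ m v 0
    λ≡min-head v = occ-head (proj₂ (min-occ v))

    finOcc⇒drop⪯min : IsFinOcc G u (m u) j w q → drop j (m u) ⪯ m w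
    finOcc⇒drop⪯min {j = j} fin = Minimal-drop j (minimal _) fin _ (min-occ _)

    occ⇒min⪯drop : IsOcc G u α o → ∀ j → m (o j) ⪯ drop j α
    occ⇒min⪯drop occ j = minimal _ _ (occ-drop j occ)

    min-suffix : IsOcc G u (m u) o → ∀ j → m (o j) ≈ drop j (m u)
    min-suffix occ j = ⪯-antisym (occ⇒min⪯drop occ j) (finOcc⇒drop⪯min (occ⇒finOcc occ j))

    min-eventually-periodic : ∀ v → ∃₂ λ A B → A < B × B ≤ n × drop A (m v) ≈ drop B (m v)
    min-eventually-periodic v with min-occ v
    ... | r , occ with Fin.pigeonhole (n<1+n n) (r ∘ toℕ)
    ... | i , j , i<j , same-node =
      toℕ i , toℕ j , i<j , Fin.toℕ≤pred[n] j ,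
      ≈-trans (≈-sym (min-suffix occ (toℕ i))) (subst (λ x → m x ≈ drop (toℕ j) (m v)) (sym same-node) (min-suffix occ (toℕ j)))

    τ-total : ∀ v → ∃ (τ G m v)
    τ-total v with min-eventually-periodic v
    ... | A , B , A<B , B≤n , period =
      Tau-total n (m v) λ agree → periodic⇒tail≈ (m v) A<B period (λ i i<B → sym (agree i (≤-trans i<B B≤n)))

    F-τ-uniform : ∀ {R t} → F G m R v → F G m R w → τ G m v t → τ G m w t
    F-τ-uniform {w = w} {t = t} (v∈R′ , v-least) (w∈R′ , w-least) τv with τ-total w
    ... | t′ , τw = subst (τ G m w) (≤-antisym (w-least _ v∈R′ t′ t τw τv) (v-least _ w∈R′ t t′ τv τw)) τw

    drop-suc≺drop : ∀ {l} → IsEll G m u l → ∀ r → 1 ≤ r → suc r < l → drop (suc r) (m u) ≺ drop r (m u)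
    drop-suc≺drop {u = u} (o , occ , _ , _ , before-ℓ) r 1≤r 1+r<l with τ-total (o r)
    ... | t , τr =
      ≺-respˡ-≈ (≈-trans (≈-sym (drop-tail r (m u))) (λ i → sym (min-suffix occ r (suc i))))
        (≺-respʳ-≈ (Tau<2⇒tail≺ τr (before-ℓ (suc r) (s≤s 1≤r) 1+r<l t τr)) (min-suffix occ r))

    module Layers (u : Fin n) (l : ℕ) (ell : IsEll G m u l) where

      private
        μ : Str k
        μ = m u

        Gᵢ : ℕ → Fin n → Set
        Gᵢ = Gset G m u

      drop≺drop : ∀ {q s} → 1 ≤ q → q < s → s < l → drop s μ ≺ drop q μ
      drop≺drop 1≤q q<s s<l =
        ≺-descending (λ j → drop j μ) (λ r q≤r r<s → drop-suc≺drop ell r (≤-trans 1≤q q≤r) (≤-<-trans r<s s<l)) q<s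

      Reach : ℕ → Fin n → Set
      Reach j w = ∃ (IsFinOcc G u μ j w)

      -- Layer p is about G_{p+1}(u) (streams are 0-based); earlier spares a strong induction for U.
      record Layer (p : ℕ) : Set where
        field
          passes   : IsOcc G u μ o → Gᵢ (suc p) (o p)
          reached  : Gᵢ (suc p) w → Reach p w
          labelled : Gᵢ (suc p) w → λ' w ≡ μ p
          earlier  : U G m u (suc p) w → ∃ λ q → 1 ≤ q × q ≤ p × Reach q w

      layer₀ : Layer 0
      layer₀ = record
        { passes   = proj₁
        ; reached  = λ { refl → (λ _ → u) , refl , refl , λ _ () }
        ; labelled = λ { refl → λ≡min-head u }
        ; earlier  = λ ()
        }

      module Step {p} (1+p<l : suc p < l) (L : Layer p) where
        open Layer L

        R : Fin n → Set
        R = InNbr G m (Gᵢ (suc p))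

        R-reached : R w → Reach (suc p) w
        R-reached (v , v∈G , e) = _ , finOcc-extend (proj₂ (reached v∈G)) e (labelled v∈G)

        R-lower : R w → drop (suc p) μ ⪯ m w
        R-lower w∈R = finOcc⇒drop⪯min (proj₂ (R-reached w∈R))

        R-λ-lower : R w → μ (suc p) ≤ᶠ λ' w
        R-λ-lower {w} w∈R = subst₂ _≤ᶠ_ (drop-head (suc p) μ) (sym (λ≡min-head w)) (⪯-head (R-lower w∈R))

        occ∈R : IsOcc G u μ o → R (o (suc p))
        occ∈R occ@(_ , edges , _) = _ , passes occ , edges p

        occ-λ-least : IsOcc G u μ o → R w → λ' (o (suc p)) ≤ᶠ λ' w
        occ-λ-least {w = w} occ@(_ , _ , labels) w∈R = subst (_≤ᶠ λ' w) (sym (labels (suc p))) (R-λ-lower w∈R)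

        occ-τ-least : IsOcc G u μ o → ArgMinλ G m R w → ∀ s t → τ G m (o (suc p)) s → τ G m w t → s ≤ t
        occ-τ-least {o = o} {w = w} occ (w∈R , w-least) _ _ =
          Tau-mono same-head (⪯-trans (occ⇒min⪯drop occ (suc p)) (R-lower w∈R))
          where
          same-head : m (o (suc p)) 0 ≡ m w 0
          same-head = trans (sym (λ≡min-head _))
            (trans (Fin.≤-antisym (occ-λ-least occ w∈R) (w-least _ (occ∈R occ))) (λ≡min-head w))

        -- A node of an earlier G_{q+1} has min string ⪰ drop q μ ≻ drop (p + 1) μ ⪰ m (o (p + 1)).
        occ-new : IsOcc G u μ o → ¬ U G m u (suc p) (o (suc p))
        occ-new occ o∈U with earlier o∈U
        ... | q , 1≤q , q≤p , (_ , fin) =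
          ≺⇒⋡ (drop≺drop 1≤q (s≤s q≤p) 1+p<l) (⪯-trans (finOcc⇒drop⪯min fin) (occ⇒min⪯drop occ (suc p)))

        layer-suc : Layer (suc p)
        layer-suc = record
          { passes   = λ occ → ((occ∈R occ , λ w → occ-λ-least occ) , λ w → occ-τ-least occ) , occ-new occ
          ; reached  = λ { (((w∈R , _) , _) , _) → R-reached w∈R }
          ; labelled = λ { (((w∈R , w-least) , _) , _) → labelled′ w∈R w-least }
          ; earlier  = λ { (inj₁ w∈U) → let q , 1≤q , q≤p , reach = earlier w∈U in q , 1≤q , m≤n⇒m≤1+n q≤p , reach
                         ; (inj₂ w∈G) → suc p , s≤s z≤n , ≤-refl , R-reached (proj₁ (proj₁ (proj₁ w∈G))) }
          }
          where
          labelled′ : R w → (∀ v → R v → λ' w ≤ᶠ λ' v) → λ' w ≡ μ (suc p)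
          labelled′ {w} w∈R w-least with min-occ u
          ... | o , occ@(_ , _ , labels) =
            Fin.≤-antisym (subst (λ' w ≤ᶠ_) (labels (suc p)) (w-least _ (occ∈R occ))) (R-λ-lower w∈R)

      layer : ∀ p → suc p ≤ l → Layer p
      layer zero    _     = layer₀
      layer (suc p) 2+p≤l = Step.layer-suc 2+p≤l (layer p (<⇒≤ 2+p≤l))

      occ∈Gᵢ : IsOcc G u μ o → ∀ i → 1 ≤ i → i ≤ l → Gᵢ i (o (i ∸ 1))
      occ∈Gᵢ occ (suc p) _ i≤l = Layer.passes (layer p i≤l) occ

      Gᵢ-reached : ∀ i → 1 ≤ i → i ≤ l → Gᵢ i w → Reach (i ∸ 1) w
      Gᵢ-reached (suc p) _ i≤l = Layer.reached (layer p i≤l)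

      Gᵢ-λ-uniform : ∀ i → i ≤ l → Gᵢ i v → Gᵢ i w → λ' v ≡ λ' w
      Gᵢ-λ-uniform (suc p) i≤l v∈G w∈G = trans (labelled v∈G) (sym (labelled w∈G))
        where open Layer (layer p i≤l)

      Gᵢ-τ-uniform : ∀ i {t} → Gᵢ i v → Gᵢ i w → τ G m v t → τ G m w t
      Gᵢ-τ-uniform (suc zero)    refl       refl       τv = τv
      Gᵢ-τ-uniform (suc (suc p)) (v∈F , _) (w∈F , _) τv = F-τ-uniform v∈F w∈F τv

-- The hypothesis τ(u) = 3 only serves to make ℓ_u exist; the proof uses the witness of IsEll.
lemma16 : ∀ {n k} (G : Graph n k) (m : Fin n → Str k) →
    (∀ v → IsMin G v (m v)) →
    ∀ (u : Fin n) → τ G m u 3 →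
    ∀ (l : ℕ) → IsEll G m u l →
      -- (1) G_i(u) is nonempty for 1 ≤ i ≤ ℓ_u
      (∀ i → 1 ≤ i → i ≤ l → ∃ λ v → Gset G m u i v)
      ×
      -- (2) any occurrence of min_u from u passes through G_i(u)
      (∀ o → IsOcc G u (m u) o → ∀ i → 1 ≤ i → i ≤ l →
         Gset G m u i (o (i ∸ 1))
         × (∀ w → Gset G m u i w →
              (Graph.λ' G w ≡ Graph.λ' G (o (i ∸ 1)))
              × (∀ t → τ G m w t ⇔ τ G m (o (i ∸ 1)) t))
         × (m u (i ∸ 1) ≡ Graph.λ' G (o (i ∸ 1))))
      ×
      -- (3) every v ∈ G_i(u) is reached by an occurrence of min_u[1,i-1]
      (∀ i → 1 ≤ i → i ≤ l → ∀ v → Gset G m u i v →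
         ∃ λ o → IsFinOcc G u (m u) (i ∸ 1) v o)
lemma16 G m mins u _ l ell@(o* , occ* , _) =
    (λ i 1≤i i≤l → o* (i ∸ 1) , occ∈Gᵢ occ* i 1≤i i≤l)
  , (λ { o occ@(_ , _ , labels) i 1≤i i≤l →
         let o∈G = occ∈Gᵢ occ i 1≤i i≤l in
           o∈G
         , (λ w w∈G → Gᵢ-λ-uniform i i≤l w∈G o∈G , λ t → mk⇔ (Gᵢ-τ-uniform i w∈G o∈G) (Gᵢ-τ-uniform i o∈G w∈G))
         , sym (labels (i ∸ 1)) })
  , (λ i 1≤i i≤l v → Gᵢ-reached i 1≤i i≤l)
  where open Layers G m mins u l ell
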